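{- Let $k$ and $r$ be positive integers with $k\geq 2$ and $1\leq r<k-1$, let $D$ be the diameter of $K(2k+r,k)$, and let $p\geq1$ be an integer with $2p\leq D$ such that $2p<D$ or $r$ divides $k-1$. Let $A$ and $B$ be two non-adjacent vertices of $K_{=2p}(2k+r,k)$ and let $s=|A\cap B|$. If $0\leq s<k-rp$, then the distance between $A$ and $B$ in $K_{=2p}(2k+r,k)$ equals $\lceil (k-s)/(rp)\rceil$.
   Context: For positive integers $n,k$, $[n]^k$ is the set of $k$-element subsets of $\{1,\dots,n\}$. The Kneser graph $K(2k+r,k)$ has vertex set $[2k+r]^k$, with $A,B$ adjacent iff $A\cap B=\emptyset$; it is connected. For a connected graph $G$ and positive integer $d$, the exact distance-$d$ graph $G_{=d}$ has the same vertex set as $G$, with two vertices adjacent iff their distance in $G$ is exactly $d$. $K_{=d}(2k+r,k)$ denotes the exact distance-$d$ graph of $K(2k+r,k)$. (The diameter of $K(2k+r,k)$ is $\lceil (k-1)/r\rceil+1$.) -}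

module Defs where

open import Data.Nat using (ℕ; zero; suc; _+_; _*_; _∸_; _<_; _/_)
open import Data.Fin.Subset using (Subset; _∩_; ⊥; ∣_∣)
open import Data.Product using (Σ; _×_; proj₁)
open import Relation.Binary.PropositionalEquality using (_≡_)
open import Relation.Nullary using (¬_)

KVertex : ℕ → ℕ → Set
KVertex n k = Σ (Subset n) (λ A → ∣ A ∣ ≡ k)

KAdj : ∀ {n k} → KVertex n k → KVertex n k → Set
KAdj A B = (proj₁ A ∩ proj₁ B) ≡ ⊥

data Walk {V : Set} (R : V → V → Set) : ℕ → V → V → Set where
  nil  : ∀ {x} → Walk R zero x x
  cons : ∀ {n x y z} → R x y → Walk R n y z → Walk R (suc n) x z

Dist : {V : Set} → (V → V → Set) → V → V → ℕ → Set
Dist R x y d = Walk R d x y × (∀ m → m < d → ¬ Walk R m x y)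

ExactAdj : {V : Set} → (V → V → Set) → ℕ → V → V → Set
ExactAdj R d x y = Dist R x y d

-- Ceiling division ⌈a/b⌉ (b = 0 gives 0, never used).
ceilDiv : ℕ → ℕ → ℕ
ceilDiv a zero = zero
ceilDiv a (suc b) = (a + b) / suc b

kneserDiam : ℕ → ℕ → ℕ
kneserDiam k r = suc (ceilDiv (k ∸ 1) r)

{-# OPTIONS --safe #-}
module Submission where

-- Write diff X Y = |X ∖ Y| = k − |X ∩ Y|.  In K(2k+r,k) a walk of even length 2q
-- forces diff ≤ rq and a walk of odd length 2q+1 forces |X ∩ Y| ≤ rq, while
-- diff ≤ rq conversely yields a walk of length 2q.  Hence X, Y are adjacent in
-- K_{=2p} whenever r(p−1) < diff ≤ rp and r(p−1) < |X ∩ Y|, and only if diff ≤ rp.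
-- Since diff satisfies the triangle inequality, a walk of length m in K_{=2p}
-- gives diff A B ≤ m·rp: the lower bound.  For the upper bound, exchange rp
-- elements of A ∖ B for elements of B ∖ A until at most 2rp differ, then finish
-- with two steps whose sizes are balanced into (r(p−1), rp]; when few elements
-- differ, this uses elements outside A ∪ B, which exist because 2p ≤ D amounts
-- to 2(r(p−1)+1) ≤ k.

open import Defs
open import Algebra.Properties.CommutativeSemigroup using (interchange)
open import Data.Bool using (Bool; true; false; _∧_; _∨_; not; T)
open import Data.Bool.Properties using (T-∧)
open import Data.Empty using (⊥-elim)
open import Data.Fin using (Fin; zero; suc)
open import Data.Fin.Subset using (Subset; _∩_; _∪_; ∁; ⊤; ⊥; ∣_∣)
open import Data.Fin.Subset.Properties using (∣p∣≤n; ∣⊤∣≡n; ∣⊥∣≡0; ∩-comm; ∩-inverseʳ; ∩-zeroˡ)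
open import Data.List using (List; []; _∷_)
open import Data.Nat
  using (ℕ; zero; suc; _+_; _*_; _∸_; _%_; _≤_; _<_; _≤ᵇ_; z≤n; s≤s; NonZero; >-nonZero; ⌊_/2⌋; ⌈_/2⌉)
open import Data.Nat.Divisibility using (_∣_)
open import Data.Nat.DivMod using (m≡m%n+[m/n]*n; m%n<n; m<n*o⇒m/o<n)
open import Data.Nat.Properties
open import Data.Nat.Tactic.RingSolver using (solve-∀)
open import Data.Product using (Σ-syntax; _×_; _,_; proj₁; proj₂)
open import Data.Sum using (_⊎_)
open import Data.Unit using (tt)
open import Data.Vec using (Vec; []; _∷_; lookup; map; head; tail)
open import Data.Vec.Properties using (lookup-map)
open import Function.Base using (_∘_)
open import Function.Bundles using (Equivalence)
open import Relation.Binary.PropositionalEquality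
  using (_≡_; refl; sym; trans; cong; cong₂; subst; module ≡-Reasoning)
open import Relation.Nullary using (¬_; yes; no)

data Formula (m : ℕ) : Set where
  var       : Fin m → Formula m
  ⊤ᶠ        : Formula m
  _∧ᶠ_ _∨ᶠ_ : Formula m → Formula m → Formula m
  ¬ᶠ_       : Formula m → Formula m

infixr 7 _∧ᶠ_
infixr 6 _∨ᶠ_
infix 8 ¬ᶠ_

χ : Bool → ℕ
χ true  = 1
χ false = 0

∣∷∣ : ∀ {n} b (S : Subset n) → ∣ b ∷ S ∣ ≡ χ b + ∣ S ∣
∣∷∣ true  S = refl
∣∷∣ false S = refl

everyAssignment : ∀ m → (Vec Bool m → Bool) → Bool
everyAssignment zero    P = P []
everyAssignment (suc m) P = everyAssignment m (P ∘ (false ∷_)) ∧ everyAssignment m (P ∘ (true ∷_))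

everyAssignment-sound : ∀ m P → T (everyAssignment m P) → ∀ α → T (P α)
everyAssignment-sound zero    P t []          = t
everyAssignment-sound (suc m) P t (false ∷ α) = everyAssignment-sound m _ (proj₁ (Equivalence.to T-∧ t)) α
everyAssignment-sound (suc m) P t (true ∷ α)  = everyAssignment-sound m _ (proj₂ (Equivalence.to T-∧ t)) α

module _ {m : ℕ} where

  eval : Formula m → Vec Bool m → Bool
  eval (var i)  α = lookup α i
  eval ⊤ᶠ       α = true
  eval (φ ∧ᶠ ψ) α = eval φ α ∧ eval ψ α
  eval (φ ∨ᶠ ψ) α = eval φ α ∨ eval ψ α
  eval (¬ᶠ φ)   α = not (eval φ α)

  ⟦_⟧ : ∀ {n} → Formula m → Vec (Subset n) m → Subset n
  ⟦ var i  ⟧ ρ = lookup ρ i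
  ⟦ ⊤ᶠ     ⟧ ρ = ⊤
  ⟦ φ ∧ᶠ ψ ⟧ ρ = ⟦ φ ⟧ ρ ∩ ⟦ ψ ⟧ ρ
  ⟦ φ ∨ᶠ ψ ⟧ ρ = ⟦ φ ⟧ ρ ∪ ⟦ ψ ⟧ ρ
  ⟦ ¬ᶠ φ   ⟧ ρ = ∁ (⟦ φ ⟧ ρ)

  ⟦⟧-∷ : ∀ {n} (φ : Formula m) (ρ : Vec (Subset (suc n)) m) →
         ⟦ φ ⟧ ρ ≡ eval φ (map head ρ) ∷ ⟦ φ ⟧ (map tail ρ)
  ⟦⟧-∷ (var i) ρ with lookup ρ i in eq
  ... | b ∷ S = cong₂ _∷_ (trans (cong head (sym eq)) (sym (lookup-map i head ρ)))
                          (trans (cong tail (sym eq)) (sym (lookup-map i tail ρ)))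
  ⟦⟧-∷ ⊤ᶠ       ρ = refl
  ⟦⟧-∷ (φ ∧ᶠ ψ) ρ rewrite ⟦⟧-∷ φ ρ | ⟦⟧-∷ ψ ρ = refl
  ⟦⟧-∷ (φ ∨ᶠ ψ) ρ rewrite ⟦⟧-∷ φ ρ | ⟦⟧-∷ ψ ρ = refl
  ⟦⟧-∷ (¬ᶠ φ)   ρ rewrite ⟦⟧-∷ φ ρ = refl

  ∣⟦⟧∣-∷ : ∀ {n} (φ : Formula m) (ρ : Vec (Subset (suc n)) m) →
           ∣ ⟦ φ ⟧ ρ ∣ ≡ χ (eval φ (map head ρ)) + ∣ ⟦ φ ⟧ (map tail ρ) ∣
  ∣⟦⟧∣-∷ φ ρ = trans (cong ∣_∣ (⟦⟧-∷ φ ρ)) (∣∷∣ (eval φ (map head ρ)) (⟦ φ ⟧ (map tail ρ)))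

  -- A singleton list is summed without a trailing "+ 0", so that the counting
  -- facts below come out in exactly the stated shape.
  count : ∀ {n} → List (Formula m) → Vec (Subset n) m → ℕ
  count []           ρ = 0
  count (φ ∷ [])     ρ = ∣ ⟦ φ ⟧ ρ ∣
  count (φ ∷ ψ ∷ φs) ρ = ∣ ⟦ φ ⟧ ρ ∣ + count (ψ ∷ φs) ρ

  countAt : List (Formula m) → Vec Bool m → ℕ
  countAt []           α = 0
  countAt (φ ∷ [])     α = χ (eval φ α)
  countAt (φ ∷ ψ ∷ φs) α = χ (eval φ α) + countAt (ψ ∷ φs) α

  count-∷ : ∀ {n} (φs : List (Formula m)) (ρ : Vec (Subset (suc n)) m) →
            count φs ρ ≡ countAt φs (map head ρ) + count φs (map tail ρ)
  count-∷ []           ρ = refl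
  count-∷ (φ ∷ [])     ρ = ∣⟦⟧∣-∷ φ ρ
  count-∷ (φ ∷ ψ ∷ φs) ρ = trans (cong₂ _+_ (∣⟦⟧∣-∷ φ ρ) (count-∷ (ψ ∷ φs) ρ))
                                 (interchange +-commutativeSemigroup (χ (eval φ (map head ρ))) _ _ _)

  count-[] : (φs : List (Formula m)) (ρ : Vec (Subset 0) m) → count φs ρ ≡ 0
  count-[] []           ρ = refl
  count-[] (φ ∷ [])     ρ = n≤0⇒n≡0 (∣p∣≤n (⟦ φ ⟧ ρ))
  count-[] (φ ∷ ψ ∷ φs) ρ = cong₂ _+_ (n≤0⇒n≡0 (∣p∣≤n (⟦ φ ⟧ ρ))) (count-[] (ψ ∷ φs) ρ)

  -- Both sides of such an inequality are sums over the points of {1..n}, so it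
  -- suffices to check it at a single point, i.e. for every truth assignment.
  Pointwise≤ : (ls rs cs : List (Formula m)) → Set
  Pointwise≤ ls rs cs = T (everyAssignment m λ α → countAt ls α ≤ᵇ countAt rs α + countAt cs α)

  count-≤-+ : ∀ ls rs cs → Pointwise≤ ls rs cs →
              ∀ {n} (ρ : Vec (Subset n) m) → count ls ρ ≤ count rs ρ + count cs ρ
  count-≤-+ ls rs cs t {zero} ρ rewrite count-[] ls ρ = z≤n
  count-≤-+ ls rs cs t {suc n} ρ rewrite count-∷ ls ρ | count-∷ rs ρ | count-∷ cs ρ =
    ≤-trans (+-mono-≤ (≤ᵇ⇒≤ _ _ (everyAssignment-sound m _ t (map head ρ)))
                      (count-≤-+ ls rs cs t (map tail ρ)))
            (≤-reflexive (interchange +-commutativeSemigroup (countAt rs (map head ρ)) _ _ _))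

  count-≤ : ∀ ls rs cs → Pointwise≤ ls rs cs →
            ∀ {n} (ρ : Vec (Subset n) m) → count cs ρ ≡ 0 → count ls ρ ≤ count rs ρ
  count-≤ ls rs cs t ρ cs≡0 = begin
    count ls ρ                ≤⟨ count-≤-+ ls rs cs t ρ ⟩
    count rs ρ + count cs ρ   ≡⟨ cong (count rs ρ +_) cs≡0 ⟩
    count rs ρ + 0            ≡⟨ +-identityʳ _ ⟩
    count rs ρ                ∎
    where open ≤-Reasoning

  count-≡ : ∀ ls rs cs → Pointwise≤ ls rs cs → Pointwise≤ rs ls cs →
            ∀ {n} (ρ : Vec (Subset n) m) → count cs ρ ≡ 0 → count ls ρ ≡ count rs ρ
  count-≡ ls rs cs t t′ ρ cs≡0 = ≤-antisym (count-≤ ls rs cs t ρ cs≡0) (count-≤ rs ls cs t′ ρ cs≡0)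

x₀ : ∀ {m} → Formula (suc m)
x₀ = var zero
x₁ : ∀ {m} → Formula (suc (suc m))
x₁ = var (suc zero)
x₂ : ∀ {m} → Formula (suc (suc (suc m)))
x₂ = var (suc (suc zero))
x₃ : ∀ {m} → Formula (suc (suc (suc (suc m))))
x₃ = var (suc (suc (suc zero)))
x₄ : ∀ {m} → Formula (suc (suc (suc (suc (suc m)))))
x₄ = var (suc (suc (suc (suc zero))))

module _ {n : ℕ} where

  ∣p∩q∣+∣p∩∁q∣≡∣p∣ : (p q : Subset n) → ∣ p ∩ q ∣ + ∣ p ∩ ∁ q ∣ ≡ ∣ p ∣
  ∣p∩q∣+∣p∩∁q∣≡∣p∣ p q =
    count-≡ (x₀ ∧ᶠ x₁ ∷ x₀ ∧ᶠ ¬ᶠ x₁ ∷ []) (x₀ ∷ []) [] tt tt (p ∷ q ∷ []) refl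

  ∣p∩∁r∣≤∣p∩∁q∣+∣q∩∁r∣ : (p q r : Subset n) → ∣ p ∩ ∁ r ∣ ≤ ∣ p ∩ ∁ q ∣ + ∣ q ∩ ∁ r ∣
  ∣p∩∁r∣≤∣p∩∁q∣+∣q∩∁r∣ p q r =
    count-≤ (x₀ ∧ᶠ ¬ᶠ x₂ ∷ []) (x₀ ∧ᶠ ¬ᶠ x₁ ∷ x₁ ∧ᶠ ¬ᶠ x₂ ∷ []) [] tt (p ∷ q ∷ r ∷ []) refl

  ∣p∩∁q∣+∣r∩∁q∣+∣q∣≤n : (p q r : Subset n) → ∣ p ∩ r ∣ ≡ 0 →
                         ∣ p ∩ ∁ q ∣ + (∣ r ∩ ∁ q ∣ + ∣ q ∣) ≤ n
  ∣p∩∁q∣+∣r∩∁q∣+∣q∣≤n p q r p∩r≡0 = subst (∣ p ∩ ∁ q ∣ + (∣ r ∩ ∁ q ∣ + ∣ q ∣) ≤_) (∣⊤∣≡n n)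
    (count-≤ (x₀ ∧ᶠ ¬ᶠ x₁ ∷ x₂ ∧ᶠ ¬ᶠ x₁ ∷ x₁ ∷ []) (⊤ᶠ ∷ []) (x₀ ∧ᶠ x₂ ∷ []) tt (p ∷ q ∷ r ∷ []) p∩r≡0)

  ∣p∩q∣≤∣q∩∁r∣ : (p q r : Subset n) → ∣ p ∩ r ∣ ≡ 0 → ∣ p ∩ q ∣ ≤ ∣ q ∩ ∁ r ∣
  ∣p∩q∣≤∣q∩∁r∣ p q r p∩r≡0 =
    count-≤ (x₀ ∧ᶠ x₁ ∷ []) (x₁ ∧ᶠ ¬ᶠ x₂ ∷ []) (x₀ ∧ᶠ x₂ ∷ []) tt (p ∷ q ∷ r ∷ []) p∩r≡0

  ∣∁p∩∁q∣+∣p∣+∣q∩∁p∣≡n : (p q : Subset n) → ∣ ∁ p ∩ ∁ q ∣ + (∣ p ∣ + ∣ q ∩ ∁ p ∣) ≡ n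
  ∣∁p∩∁q∣+∣p∣+∣q∩∁p∣≡n p q = trans
    (count-≡ (¬ᶠ x₀ ∧ᶠ ¬ᶠ x₁ ∷ x₀ ∷ x₁ ∧ᶠ ¬ᶠ x₀ ∷ []) (⊤ᶠ ∷ []) [] tt tt (p ∷ q ∷ []) refl)
    (∣⊤∣≡n n)

  -- Inclusion t ⊆ s is expressed throughout as ∣ t ∩ ∁ s ∣ ≡ 0, the form the counting lemmas consume.
  outside-disjointˡ : (p q t : Subset n) → ∣ t ∩ ∁ (∁ p ∩ ∁ q) ∣ ≡ 0 → ∣ p ∩ t ∣ ≡ 0
  outside-disjointˡ p q t t⊆ = n≤0⇒n≡0
    (count-≤ (x₀ ∧ᶠ x₂ ∷ []) [] (x₂ ∧ᶠ ¬ᶠ (¬ᶠ x₀ ∧ᶠ ¬ᶠ x₁) ∷ []) tt (p ∷ q ∷ t ∷ []) t⊆)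

  outside-disjointʳ : (p q t : Subset n) → ∣ t ∩ ∁ (∁ p ∩ ∁ q) ∣ ≡ 0 → ∣ t ∩ q ∣ ≡ 0
  outside-disjointʳ p q t t⊆ = n≤0⇒n≡0
    (count-≤ (x₂ ∧ᶠ x₁ ∷ []) [] (x₂ ∧ᶠ ¬ᶠ (¬ᶠ x₀ ∧ᶠ ¬ᶠ x₁) ∷ []) tt (p ∷ q ∷ t ∷ []) t⊆)

  module Exchange (p q u w z : Subset n)
    (u⊆p∖q : ∣ u ∩ ∁ (p ∩ ∁ q) ∣ ≡ 0) (w⊆q∖p : ∣ w ∩ ∁ (q ∩ ∁ p) ∣ ≡ 0)
    (z⊆∁p∩∁q : ∣ z ∩ ∁ (∁ p ∩ ∁ q) ∣ ≡ 0) where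

    p′ : Subset n
    p′ = (p ∩ ∁ u) ∪ w ∪ z

    private
      ρ : Vec (Subset n) 5
      ρ = p ∷ q ∷ u ∷ w ∷ z ∷ []
      p′ᶠ : Formula 5
      p′ᶠ = (x₀ ∧ᶠ ¬ᶠ x₂) ∨ᶠ x₃ ∨ᶠ x₄
      inclusions : List (Formula 5)
      inclusions = x₂ ∧ᶠ ¬ᶠ (x₀ ∧ᶠ ¬ᶠ x₁) ∷ x₃ ∧ᶠ ¬ᶠ (x₁ ∧ᶠ ¬ᶠ x₀) ∷ x₄ ∧ᶠ ¬ᶠ (¬ᶠ x₀ ∧ᶠ ¬ᶠ x₁) ∷ []
      inclusions-hold : count inclusions ρ ≡ 0
      inclusions-hold = cong₂ _+_ u⊆p∖q (cong₂ _+_ w⊆q∖p z⊆∁p∩∁q)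

    ∣p′∣+∣u∣ : ∣ p′ ∣ + ∣ u ∣ ≡ ∣ p ∣ + (∣ w ∣ + ∣ z ∣)
    ∣p′∣+∣u∣ = count-≡ (p′ᶠ ∷ x₂ ∷ []) (x₀ ∷ x₃ ∷ x₄ ∷ []) inclusions tt tt ρ inclusions-hold

    ∣p∩∁p′∣ : ∣ p ∩ ∁ p′ ∣ ≡ ∣ u ∣
    ∣p∩∁p′∣ = count-≡ (x₀ ∧ᶠ ¬ᶠ p′ᶠ ∷ []) (x₂ ∷ []) inclusions tt tt ρ inclusions-hold

    ∣p′∩∁q∣+∣u∣ : ∣ p′ ∩ ∁ q ∣ + ∣ u ∣ ≡ ∣ p ∩ ∁ q ∣ + ∣ z ∣
    ∣p′∩∁q∣+∣u∣ =
      count-≡ (p′ᶠ ∧ᶠ ¬ᶠ x₁ ∷ x₂ ∷ []) (x₀ ∧ᶠ ¬ᶠ x₁ ∷ x₄ ∷ []) inclusions tt tt ρ inclusions-hold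

⊆-ofSize : ∀ {n} (s : Subset n) j → j ≤ ∣ s ∣ → Σ[ t ∈ Subset n ] ∣ t ∣ ≡ j × ∣ t ∩ ∁ s ∣ ≡ 0
⊆-ofSize {n} s zero _ = ⊥ , ∣⊥∣≡0 n , trans (cong ∣_∣ (∩-zeroˡ (∁ s))) (∣⊥∣≡0 n)
⊆-ofSize (true ∷ s) (suc j) (s≤s j≤∣s∣) with ⊆-ofSize s j j≤∣s∣
... | t , ∣t∣≡j , t⊆s = true ∷ t , cong suc ∣t∣≡j , t⊆s
⊆-ofSize (false ∷ s) (suc j) 1+j≤∣s∣ with ⊆-ofSize s (suc j) 1+j≤∣s∣
... | t , ∣t∣≡1+j , t⊆s = false ∷ t , ∣t∣≡1+j , t⊆s

∣p∣≡0⇒p≡⊥ : ∀ {n} (p : Subset n) → ∣ p ∣ ≡ 0 → p ≡ ⊥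
∣p∣≡0⇒p≡⊥ []          _ = refl
∣p∣≡0⇒p≡⊥ (false ∷ p) ∣p∣≡0 = cong (false ∷_) (∣p∣≡0⇒p≡⊥ p ∣p∣≡0)

ceilDiv≤⇒≤* : ∀ a b m .{{_ : NonZero b}} → ceilDiv a b ≤ m → a ≤ m * b
ceilDiv≤⇒≤* a (suc b) m c≤m = +-cancelʳ-≤ b a (m * suc b) (begin
  a + b                                        ≡⟨ m≡m%n+[m/n]*n (a + b) (suc b) ⟩
  (a + b) % suc b + ceilDiv a (suc b) * suc b  ≤⟨ +-mono-≤ (<⇒≤pred (m%n<n (a + b) (suc b)))
                                                            (*-monoˡ-≤ (suc b) c≤m) ⟩
  b + m * suc b                                ≡⟨ +-comm b (m * suc b) ⟩
  m * suc b + b                                ∎)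
  where open ≤-Reasoning

≤*⇒ceilDiv≤ : ∀ a b m .{{_ : NonZero b}} → a ≤ m * b → ceilDiv a b ≤ m
≤*⇒ceilDiv≤ a (suc b) m a≤mb = <⇒≤pred (m<n*o⇒m/o<n (begin-strict
  a + b                ≤⟨ +-monoˡ-≤ b a≤mb ⟩
  m * suc b + b        <⟨ n<1+n (m * suc b + b) ⟩
  suc (m * suc b + b)  ≡⟨ cong suc (+-comm (m * suc b) b) ⟩
  suc m * suc b        ∎))
  where open ≤-Reasoning

ceilDiv≡suc⇒*< : ∀ a b c .{{_ : NonZero b}} → ceilDiv a b ≡ suc c → c * b < a
ceilDiv≡suc⇒*< a b c c≡ = ≰⇒> λ a≤cb → 1+n≰n (subst (_≤ c) c≡ (≤*⇒ceilDiv≤ a b c a≤cb))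

m<n∸o⇒m+o<n : ∀ m n o → m < n ∸ o → m + o < n
m<n∸o⇒m+o<n m n o m<n∸o = m≤o∸n⇒m+n≤o (suc m) o≤n m<n∸o
  where
  o≤n : o ≤ n
  o≤n = <⇒≤ (m∸n≢0⇒n<m λ n∸o≡0 → n≮0 (subst (m <_) n∸o≡0 m<n∸o))

data Parity : ℕ → Set where
  even : ∀ q → Parity (q + q)
  odd  : ∀ q → Parity (suc (q + q))

parity : ∀ m → Parity m
parity zero = even 0
parity (suc m) with parity m
... | even q = odd q
... | odd q  = subst Parity (cong suc (+-suc q q)) (even (suc q))

_++ʷ_ : ∀ {V : Set} {R : V → V → Set} {m n x y z} → Walk R m x y → Walk R n y z → Walk R (m + n) x z
nil        ++ʷ w′ = w′
cons xRy w ++ʷ w′ = cons xRy (w ++ʷ w′)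

module Kneser (k r : ℕ) where

  V : Set
  V = KVertex (2 * k + r) k

  _~_ : V → V → Set
  _~_ = KAdj

  meet diff outside : V → V → ℕ
  meet    X Y = ∣ proj₁ X ∩ proj₁ Y ∣
  diff    X Y = ∣ proj₁ X ∩ ∁ (proj₁ Y) ∣
  outside X Y = ∣ ∁ (proj₁ X) ∩ ∁ (proj₁ Y) ∣

  2k+r≡k+[k+r] : 2 * k + r ≡ k + (k + r)
  2k+r≡k+[k+r] = trans (cong (λ t → k + t + r) (+-identityʳ k)) (+-assoc k k r)

  meet+diff≡k : ∀ X Y → meet X Y + diff X Y ≡ k
  meet+diff≡k (X , ∣X∣≡k) (Y , _) = trans (∣p∩q∣+∣p∩∁q∣≡∣p∣ X Y) ∣X∣≡k

  meet-comm : ∀ X Y → meet X Y ≡ meet Y X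
  meet-comm X Y = cong ∣_∣ (∩-comm (proj₁ X) (proj₁ Y))

  diff-comm : ∀ X Y → diff X Y ≡ diff Y X
  diff-comm X Y = +-cancelˡ-≡ (meet X Y) _ _ (begin
    meet X Y + diff X Y ≡⟨ meet+diff≡k X Y ⟩
    k                   ≡⟨ meet+diff≡k Y X ⟨
    meet Y X + diff Y X ≡⟨ cong (_+ diff Y X) (meet-comm Y X) ⟩
    meet X Y + diff Y X ∎)
    where open ≡-Reasoning

  diff-self : ∀ X → diff X X ≡ 0
  diff-self (X , _) = trans (cong ∣_∣ (∩-inverseʳ X)) (∣⊥∣≡0 (2 * k + r))

  diff-triangle : ∀ X Y Z → diff X Z ≤ diff X Y + diff Y Z
  diff-triangle X Y Z = ∣p∩∁r∣≤∣p∩∁q∣+∣q∩∁r∣ (proj₁ X) (proj₁ Y) (proj₁ Z)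

  diff≤k : ∀ X Y → diff X Y ≤ k
  diff≤k X Y = subst (diff X Y ≤_) (meet+diff≡k X Y) (m≤n+m (diff X Y) (meet X Y))

  outside+k+diff : ∀ X Y → outside X Y + (k + diff X Y) ≡ 2 * k + r
  outside+k+diff X Y = begin
    outside X Y + (k + diff X Y)           ≡⟨ cong₂ (λ a b → outside X Y + (a + b))
                                                    (sym (proj₂ X)) (diff-comm X Y) ⟩
    outside X Y + (∣ proj₁ X ∣ + diff Y X) ≡⟨ ∣∁p∩∁q∣+∣p∣+∣q∩∁p∣≡n (proj₁ X) (proj₁ Y) ⟩
    2 * k + r                              ∎
    where open ≡-Reasoning

  ~⇒meet≡0 : ∀ X Y → X ~ Y → meet X Y ≡ 0
  ~⇒meet≡0 X Y X~Y = trans (cong ∣_∣ X~Y) (∣⊥∣≡0 (2 * k + r))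

  meet≡0⇒~ : ∀ X Y → meet X Y ≡ 0 → X ~ Y
  meet≡0⇒~ X Y = ∣p∣≡0⇒p≡⊥ (proj₁ X ∩ proj₁ Y)

  ~⇒diff≤r+meet : ∀ X Y Z → X ~ Z → diff X Y ≤ r + meet Z Y
  ~⇒diff≤r+meet X Y Z X~Z = +-cancelʳ-≤ (diff Z Y + k) _ _ (begin
    diff X Y + (diff Z Y + k)           ≤⟨ subst (λ a → diff X Y + (diff Z Y + a) ≤ 2 * k + r) (proj₂ Y)
                                             (∣p∩∁q∣+∣r∩∁q∣+∣q∣≤n (proj₁ X) (proj₁ Y) (proj₁ Z)
                                                                    (~⇒meet≡0 X Z X~Z)) ⟩
    2 * k + r                           ≡⟨ subst (λ a → 2 * a + r ≡ (r + meet Z Y) + (diff Z Y + a))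
                                             (meet+diff≡k Z Y) (regroup (meet Z Y) (diff Z Y) r) ⟩
    (r + meet Z Y) + (diff Z Y + k)     ∎)
    where
    open ≤-Reasoning
    regroup : ∀ m d t → 2 * (m + d) + t ≡ (t + m) + (d + (m + d))
    regroup = solve-∀

  ~⇒meet≤diff : ∀ X Y Z → X ~ Z → meet X Y ≤ diff Z Y
  ~⇒meet≤diff X Y Z X~Z = subst (meet X Y ≤_) (diff-comm Y Z)
    (∣p∩q∣≤∣q∩∁r∣ (proj₁ X) (proj₁ Y) (proj₁ Z) (~⇒meet≡0 X Z X~Z))

  evenWalk⇒diff≤ : ∀ q {X Y} → Walk _~_ (q + q) X Y → diff X Y ≤ r * q
  oddWalk⇒meet≤  : ∀ q {X Y} → Walk _~_ (suc (q + q)) X Y → meet X Y ≤ r * q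

  evenWalk⇒diff≤ zero    {X}     nil = ≤-trans (≤-reflexive (diff-self X)) z≤n
  evenWalk⇒diff≤ (suc q) {X} {Y} (cons {y = Z} X~Z w) = begin
    diff X Y      ≤⟨ ~⇒diff≤r+meet X Y Z X~Z ⟩
    r + meet Z Y  ≤⟨ +-monoʳ-≤ r (oddWalk⇒meet≤ q (subst (λ l → Walk _~_ l Z Y) (+-suc q q) w)) ⟩
    r + r * q     ≡⟨ *-suc r q ⟨
    r * suc q     ∎
    where open ≤-Reasoning

  oddWalk⇒meet≤ q {X} {Y} (cons {y = Z} X~Z w) = ≤-trans (~⇒meet≤diff X Y Z X~Z) (evenWalk⇒diff≤ q w)

  walk₂-of-diff≤r : ∀ {X Y} → diff X Y ≤ r → Walk _~_ 2 X Y
  walk₂-of-diff≤r {X} {Y} diff≤r with ⊆-ofSize (∁ (proj₁ X) ∩ ∁ (proj₁ Y)) k k≤outside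
    where
    k≤outside : k ≤ outside X Y
    k≤outside = +-cancelʳ-≤ (k + diff X Y) k (outside X Y) (begin
      k + (k + diff X Y)            ≤⟨ +-monoʳ-≤ k (+-monoʳ-≤ k diff≤r) ⟩
      k + (k + r)                   ≡⟨ 2k+r≡k+[k+r] ⟨
      2 * k + r                     ≡⟨ outside+k+diff X Y ⟨
      outside X Y + (k + diff X Y)  ∎)
      where open ≤-Reasoning
  ... | T , ∣T∣≡k , T⊆outside = cons {y = Z} (meet≡0⇒~ X Z (outside-disjointˡ _ _ T T⊆outside))
                                  (cons (meet≡0⇒~ Z Y (outside-disjointʳ _ _ T T⊆outside)) nil)
    where
    Z : V
    Z = T , ∣T∣≡k

  exchange : ∀ X Y v z → v + z ≤ diff X Y → z ≤ outside X Y →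
             Σ[ X′ ∈ V ] diff X X′ ≡ v + z × diff X′ Y + v ≡ diff X Y
  exchange X Y v z v+z≤diff z≤outside
    with ⊆-ofSize (proj₁ X ∩ ∁ (proj₁ Y)) (v + z) v+z≤diff
       | ⊆-ofSize (proj₁ Y ∩ ∁ (proj₁ X)) v v≤diffYX
       | ⊆-ofSize (∁ (proj₁ X) ∩ ∁ (proj₁ Y)) z z≤outside
    where
    v≤diffYX : v ≤ diff Y X
    v≤diffYX = ≤-trans (m≤m+n v z) (subst (v + z ≤_) (diff-comm X Y) v+z≤diff)
  ... | U , ∣U∣≡v+z , U⊆ | W , ∣W∣≡v , W⊆ | Z , ∣Z∣≡z , Z⊆ =
    (p′ , ∣p′∣≡k) , trans ∣p∩∁p′∣ ∣U∣≡v+z , +-cancelʳ-≡ z _ _ diff′+v+z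
    where
    open Exchange (proj₁ X) (proj₁ Y) U W Z U⊆ W⊆ Z⊆
    ∣p′∣≡k : ∣ p′ ∣ ≡ k
    ∣p′∣≡k = +-cancelʳ-≡ (v + z) _ _ (begin
      ∣ p′ ∣ + (v + z)               ≡⟨ cong (∣ p′ ∣ +_) ∣U∣≡v+z ⟨
      ∣ p′ ∣ + ∣ U ∣                 ≡⟨ ∣p′∣+∣u∣ ⟩
      ∣ proj₁ X ∣ + (∣ W ∣ + ∣ Z ∣)   ≡⟨ cong₂ (λ a b → a + (b + ∣ Z ∣)) (proj₂ X) ∣W∣≡v ⟩
      k + (v + ∣ Z ∣)                ≡⟨ cong (λ c → k + (v + c)) ∣Z∣≡z ⟩
      k + (v + z)                    ∎)
      where open ≡-Reasoning
    diff′+v+z : ∣ p′ ∩ ∁ (proj₁ Y) ∣ + v + z ≡ diff X Y + z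
    diff′+v+z = begin
      ∣ p′ ∩ ∁ (proj₁ Y) ∣ + v + z    ≡⟨ +-assoc _ v z ⟩
      ∣ p′ ∩ ∁ (proj₁ Y) ∣ + (v + z)  ≡⟨ cong (∣ p′ ∩ ∁ (proj₁ Y) ∣ +_) ∣U∣≡v+z ⟨
      ∣ p′ ∩ ∁ (proj₁ Y) ∣ + ∣ U ∣    ≡⟨ ∣p′∩∁q∣+∣u∣ ⟩
      diff X Y + ∣ Z ∣                ≡⟨ cong (diff X Y +_) ∣Z∣≡z ⟩
      diff X Y + z                   ∎
      where open ≡-Reasoning

  step-toward : ∀ X Y c → diff X Y ≤ r + c → Σ[ X′ ∈ V ] diff X X′ ≤ r × diff X′ Y ≤ c
  step-toward X Y c diff≤r+c with diff X Y ≤? r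
  ... | yes diff≤r = Y , diff≤r , ≤-trans (≤-reflexive (diff-self Y)) z≤n
  ... | no  diff≰r with exchange X Y r 0 (subst (_≤ diff X Y) (sym (+-identityʳ r)) (≰⇒≥ diff≰r)) z≤n
  ...   | X′ , diffXX′≡r , diffX′Y+r≡diff =
    X′ , ≤-reflexive (trans diffXX′≡r (+-identityʳ r)) , +-cancelʳ-≤ r _ _ (begin
      diff X′ Y + r  ≡⟨ diffX′Y+r≡diff ⟩
      diff X Y       ≤⟨ diff≤r+c ⟩
      r + c          ≡⟨ +-comm r c ⟩
      c + r          ∎)
    where open ≤-Reasoning

  walk-of-diff≤ : ∀ q {X Y} → diff X Y ≤ r * suc q → Walk _~_ (suc q + suc q) X Y
  walk-of-diff≤ zero    {X} {Y} diff≤r = walk₂-of-diff≤r (subst (diff X Y ≤_) (*-identityʳ r) diff≤r)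
  walk-of-diff≤ (suc q) {X} {Y} diff≤
    with step-toward X Y (r * suc q) (subst (diff X Y ≤_) (*-suc r (suc q)) diff≤)
  ... | X′ , diff≤r , diff′≤ = subst (λ l → Walk _~_ l X Y) (cong suc (sym (+-suc (suc q) (suc q))))
                                 (walk₂-of-diff≤r {X} {X′} diff≤r ++ʷ walk-of-diff≤ q diff′≤)

  -- The paper's p is suc p′, so that lo = r(p − 1) and hi = rp.
  module ExactDistance (p′ : ℕ) where

    lo hi : ℕ
    lo = r * p′
    hi = r * suc p′

    _~₂ₚ_ : V → V → Set
    _~₂ₚ_ = ExactAdj _~_ (2 * suc p′)

    2p≡p+p : 2 * suc p′ ≡ suc p′ + suc p′
    2p≡p+p = cong (suc p′ +_) (+-identityʳ (suc p′))

    -- lo + d < k says that the meet k − d of the two vertices exceeds lo.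
    Window : ℕ → Set
    Window d = lo < d × d ≤ hi × lo + d < k

    window⇒~₂ₚ : ∀ {X Y} → Window (diff X Y) → X ~₂ₚ Y
    window⇒~₂ₚ {X} {Y} (lo<diff , diff≤hi , lo+diff<k) =
      subst (λ l → Walk _~_ l X Y) (sym 2p≡p+p) (walk-of-diff≤ p′ diff≤hi) , no-shorter
      where
      lo<meet : lo < meet X Y
      lo<meet = +-cancelʳ-< (diff X Y) lo (meet X Y)
                  (subst (lo + diff X Y <_) (sym (meet+diff≡k X Y)) lo+diff<k)
      half≤p′ : ∀ {q} → q + q < 2 * suc p′ → q ≤ p′
      half≤p′ {q} q+q<2p = ≤-pred (≰⇒> λ p≤q →
        <⇒≱ q+q<2p (subst (_≤ q + q) (sym 2p≡p+p) (+-mono-≤ p≤q p≤q)))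
      no-shorter : ∀ m → m < 2 * suc p′ → ¬ Walk _~_ m X Y
      no-shorter m m<2p w with parity m
      ... | even q = <⇒≱ lo<diff (≤-trans (evenWalk⇒diff≤ q w) (*-monoʳ-≤ r (half≤p′ m<2p)))
      ... | odd q  = <⇒≱ lo<meet
                       (≤-trans (oddWalk⇒meet≤ q w) (*-monoʳ-≤ r (half≤p′ (<-trans (n<1+n (q + q)) m<2p))))

    ~₂ₚ⇒diff≤hi : ∀ {X Y} → X ~₂ₚ Y → diff X Y ≤ hi
    ~₂ₚ⇒diff≤hi {X} {Y} (w , _) = evenWalk⇒diff≤ (suc p′) (subst (λ l → Walk _~_ l X Y) 2p≡p+p w)

    walk⇒diff≤ : ∀ {m X Y} → Walk _~₂ₚ_ m X Y → diff X Y ≤ m * hi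
    walk⇒diff≤ {X = X} nil = ≤-reflexive (diff-self X)
    walk⇒diff≤ {X = X} {Y} (cons {y = Z} X~Z w) =
      ≤-trans (diff-triangle X Z Y) (+-mono-≤ (~₂ₚ⇒diff≤hi X~Z) (walk⇒diff≤ w))

    windows : ∀ {a b} → lo < a → lo < b → a ≤ hi → b ≤ hi → a + b ≤ k → Window a × Window b
    windows {a} {b} lo<a lo<b a≤hi b≤hi a+b≤k =
      (lo<a , a≤hi , (begin-strict
        lo + a  <⟨ +-monoˡ-< a lo<b ⟩
        b + a   ≡⟨ +-comm b a ⟩
        a + b   ≤⟨ a+b≤k ⟩
        k       ∎)) ,
      (lo<b , b≤hi , ≤-trans (+-monoˡ-< b lo<a) a+b≤k)
      where open ≤-Reasoning

    -- The middle vertex X′ swaps v = e − d elements of X ∖ Y for elements of Y ∖ X and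
    -- z = u − v more for elements outside X ∪ Y, so that diff X X′ = u and diff X′ Y = d.
    two-window-steps : ∀ {X Y} u d → Window u → Window d → u ≤ diff X Y → d ≤ diff X Y →
                       diff X Y ≤ u + d → u + d ≤ k + r → Walk _~₂ₚ_ 2 X Y
    two-window-steps {X} {Y} u d window-u window-d u≤e d≤e e≤u+d u+d≤k+r =
      cons {y = X′} (window⇒~₂ₚ (subst Window (sym diffXX′≡u) window-u))
        (cons (window⇒~₂ₚ (subst Window (sym diffX′Y≡d) window-d)) nil)
      where
      e v z : ℕ
      e = diff X Y
      v = e ∸ d
      z = u ∸ v
      v≤u : v ≤ u
      v≤u = m≤n+o⇒m∸n≤o e d (subst (e ≤_) (+-comm u d) e≤u+d)
      v+z≡u : v + z ≡ u
      v+z≡u = m+[n∸m]≡n v≤u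
      v+d≡e : v + d ≡ e
      v+d≡e = m∸n+n≡m d≤e
      regroup : ∀ a b c d → a + (b + (c + d)) ≡ b + ((c + a) + d)
      regroup = solve-∀
      z≤outside : z ≤ outside X Y
      z≤outside = +-cancelʳ-≤ (k + e) z (outside X Y) (begin
        z + (k + e)              ≡⟨ cong (λ t → z + (k + t)) v+d≡e ⟨
        z + (k + (v + d))        ≡⟨ regroup z k v d ⟩
        k + ((v + z) + d)        ≡⟨ cong (λ t → k + (t + d)) v+z≡u ⟩
        k + (u + d)              ≤⟨ +-monoʳ-≤ k u+d≤k+r ⟩
        k + (k + r)              ≡⟨ 2k+r≡k+[k+r] ⟨
        2 * k + r                ≡⟨ outside+k+diff X Y ⟨
        outside X Y + (k + e)    ∎)
        where open ≤-Reasoning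
      step : Σ[ X′ ∈ V ] diff X X′ ≡ v + z × diff X′ Y + v ≡ e
      step = exchange X Y v z (subst (_≤ e) (sym v+z≡u) u≤e) z≤outside
      X′ : V
      X′ = proj₁ step
      diffXX′≡u : diff X X′ ≡ u
      diffXX′≡u = trans (proj₁ (proj₂ step)) v+z≡u
      diffX′Y≡d : diff X′ Y ≡ d
      diffX′Y≡d = +-cancelʳ-≡ v _ _ (trans (proj₂ (proj₂ step)) (trans (sym v+d≡e) (+-comm v d)))

    module _ {{_ : NonZero r}} (room : suc lo + suc lo ≤ k) where

      lo<hi : lo < hi
      lo<hi = *-monoʳ-< r (n<1+n p′)

      two-steps-of-diff≤2hi : ∀ {X Y} → hi < diff X Y → diff X Y ≤ hi + hi → Walk _~₂ₚ_ 2 X Y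
      two-steps-of-diff≤2hi {X} {Y} hi<e e≤2hi with suc lo + suc lo ≤? diff X Y
      ... | yes 2[1+lo]≤e =
        two-window-steps ⌊ e /2⌋ ⌈ e /2⌉ (proj₁ halves) (proj₂ halves) (⌊n/2⌋≤n e) (⌈n/2⌉≤n e)
                         (≤-reflexive (sym ⌊e/2⌋+⌈e/2⌉≡e)) (≤-trans ⌊e/2⌋+⌈e/2⌉≤k (m≤m+n k r))
        where
        e : ℕ
        e = diff X Y
        ⌊e/2⌋+⌈e/2⌉≡e : ⌊ e /2⌋ + ⌈ e /2⌉ ≡ e
        ⌊e/2⌋+⌈e/2⌉≡e = ⌊n/2⌋+⌈n/2⌉≡n e
        ⌊e/2⌋+⌈e/2⌉≤k : ⌊ e /2⌋ + ⌈ e /2⌉ ≤ k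
        ⌊e/2⌋+⌈e/2⌉≤k = subst (_≤ k) (sym ⌊e/2⌋+⌈e/2⌉≡e) (diff≤k X Y)
        lo<⌊e/2⌋ : lo < ⌊ e /2⌋
        lo<⌊e/2⌋ = subst (_≤ ⌊ e /2⌋) (sym (n≡⌊n+n/2⌋ (suc lo))) (⌊n/2⌋-mono 2[1+lo]≤e)
        ⌈e/2⌉≤hi : ⌈ e /2⌉ ≤ hi
        ⌈e/2⌉≤hi = subst (⌈ e /2⌉ ≤_) (sym (n≡⌈n+n/2⌉ hi)) (⌈n/2⌉-mono e≤2hi)
        halves : Window ⌊ e /2⌋ × Window ⌈ e /2⌉
        halves = windows lo<⌊e/2⌋ (≤-trans lo<⌊e/2⌋ (⌊n/2⌋≤⌈n/2⌉ e))
                         (≤-trans (⌊n/2⌋≤⌈n/2⌉ e) ⌈e/2⌉≤hi) ⌈e/2⌉≤hi ⌊e/2⌋+⌈e/2⌉≤k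
      ... | no 2[1+lo]≰e =
        two-window-steps (suc lo) (suc lo) window-1+lo window-1+lo 1+lo≤e 1+lo≤e
                         (<⇒≤ (≰⇒> 2[1+lo]≰e)) (≤-trans room (m≤m+n k r))
        where
        window-1+lo : Window (suc lo)
        window-1+lo = proj₁ (windows ≤-refl ≤-refl lo<hi lo<hi room)
        1+lo≤e : suc lo ≤ diff X Y
        1+lo≤e = ≤-trans lo<hi (<⇒≤ hi<e)

      steps-of-diff≤ : ∀ c {X Y} → suc c * hi < diff X Y → diff X Y ≤ suc (suc c) * hi →
                       Walk _~₂ₚ_ (suc (suc c)) X Y
      steps-of-diff≤ zero    {X} {Y} hi<e e≤2hi =
        two-steps-of-diff≤2hi (subst (_< diff X Y) (*-identityˡ hi) hi<e)
                              (subst (diff X Y ≤_) (cong (hi +_) (*-identityˡ hi)) e≤2hi)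
      steps-of-diff≤ (suc c) {X} {Y} lower upper =
        cons {y = X′} (window⇒~₂ₚ (subst Window (sym diffXX′≡hi) window-hi))
          (steps-of-diff≤ c lower′ upper′)
        where
        e : ℕ
        e = diff X Y
        step : Σ[ X′ ∈ V ] diff X X′ ≡ hi + 0 × diff X′ Y + hi ≡ e
        step = exchange X Y hi 0 (≤-trans (+-monoʳ-≤ hi z≤n) (<⇒≤ lower)) z≤n
        X′ : V
        X′ = proj₁ step
        diffXX′≡hi : diff X X′ ≡ hi
        diffXX′≡hi = trans (proj₁ (proj₂ step)) (+-identityʳ hi)
        hi+diff′≡e : hi + diff X′ Y ≡ e
        hi+diff′≡e = trans (+-comm hi _) (proj₂ (proj₂ step))
        window-hi : Window hi
        window-hi = lo<hi , ≤-refl , (begin-strict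
          lo + hi                  <⟨ +-monoˡ-< hi lo<hi ⟩
          hi + hi                  ≤⟨ +-monoʳ-≤ hi (m≤m+n hi (c * hi)) ⟩
          suc (suc c) * hi         <⟨ lower ⟩
          e                        ≤⟨ diff≤k X Y ⟩
          k                        ∎)
          where open ≤-Reasoning
        lower′ : suc c * hi < diff X′ Y
        lower′ = +-cancelˡ-< hi _ _ (subst (suc (suc c) * hi <_) (sym hi+diff′≡e) lower)
        upper′ : diff X′ Y ≤ suc (suc c) * hi
        upper′ = +-cancelˡ-≤ hi _ _ (subst (_≤ suc (suc (suc c)) * hi) (sym hi+diff′≡e) upper)

      instance
        hi≢0 : NonZero hi
        hi≢0 = m*n≢0 r (suc p′)

      dist≡ceilDiv : ∀ {X Y} → hi < diff X Y → Dist _~₂ₚ_ X Y (ceilDiv (diff X Y) hi)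
      dist≡ceilDiv {X} {Y} hi<e = shortest , no-shorter
        where
        e : ℕ
        e = diff X Y
        no-shorter : ∀ m → m < ceilDiv e hi → ¬ Walk _~₂ₚ_ m X Y
        no-shorter m m<c w = <⇒≱ m<c (≤*⇒ceilDiv≤ e hi m (walk⇒diff≤ w))
        shortest : Walk _~₂ₚ_ (ceilDiv e hi) X Y
        shortest with ceilDiv e hi in c≡
        ... | zero        = ⊥-elim (<⇒≱ hi<e (≤-trans (ceilDiv≤⇒≤* e hi 0 (≤-reflexive c≡)) z≤n))
        ... | suc zero    =
          ⊥-elim (<⇒≱ hi<e (subst (e ≤_) (*-identityˡ hi) (ceilDiv≤⇒≤* e hi 1 (≤-reflexive c≡))))
        ... | suc (suc c) =
          steps-of-diff≤ c (ceilDiv≡suc⇒*< e hi (suc c) c≡) (ceilDiv≤⇒≤* e hi (suc (suc c)) (≤-reflexive c≡))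

diameter⇒room : ∀ k r p′ .{{_ : NonZero r}} → 1 ≤ k → 2 * suc p′ ≤ kneserDiam k r →
                suc (r * p′) + suc (r * p′) ≤ k
diameter⇒room k r p′ 1≤k 2p≤D =
  subst (_≤ k) (regroup p′ r) (m≤o∸n⇒m+n≤o (suc (2 * p′ * r)) 1≤k 2p′r<k∸1)
  where
  2p′<ceil : 2 * p′ < ceilDiv (k ∸ 1) r
  2p′<ceil = ≤-pred (subst (_≤ kneserDiam k r) (*-suc 2 p′) 2p≤D)
  2p′r<k∸1 : 2 * p′ * r < k ∸ 1
  2p′r<k∸1 = ≰⇒> λ k∸1≤2p′r → <⇒≱ 2p′<ceil (≤*⇒ceilDiv≤ (k ∸ 1) r (2 * p′) k∸1≤2p′r)
  regroup : ∀ p′ r → suc (2 * p′ * r) + 1 ≡ suc (r * p′) + suc (r * p′)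
  regroup = solve-∀

mainTheorem10 : (k r p : ℕ) → 2 ≤ k → 1 ≤ r → r < k ∸ 1
    → 1 ≤ p → 2 * p ≤ kneserDiam k r → (2 * p < kneserDiam k r ⊎ r ∣ (k ∸ 1))
    → (A B : KVertex (2 * k + r) k)
    → ¬ ExactAdj KAdj (2 * p) A B
    → ∣ proj₁ A ∩ proj₁ B ∣ < k ∸ r * p
    → Dist (ExactAdj KAdj (2 * p)) A B (ceilDiv (k ∸ ∣ proj₁ A ∩ proj₁ B ∣) (r * p))
mainTheorem10 k r (suc p′) 2≤k 1≤r _ (s≤s z≤n) 2p≤D _ A B _ s<k∸hi =
  subst (Dist _~₂ₚ_ A B) (cong (λ e → ceilDiv e hi) (sym k∸meet≡diff)) (dist≡ceilDiv room hi<diff)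
  where
  instance
    r≢0 : NonZero r
    r≢0 = >-nonZero 1≤r
  open Kneser k r
  open ExactDistance p′
  room : suc lo + suc lo ≤ k
  room = diameter⇒room k r p′ (<⇒≤ 2≤k) 2p≤D
  k∸meet≡diff : k ∸ meet A B ≡ diff A B
  k∸meet≡diff = trans (cong (_∸ meet A B) (sym (meet+diff≡k A B))) (m+n∸m≡n (meet A B) (diff A B))
  hi<diff : hi < diff A B
  hi<diff = +-cancelˡ-< (meet A B) hi (diff A B)
    (subst (meet A B + hi <_) (sym (meet+diff≡k A B)) (m<n∸o⇒m+o<n (meet A B) k hi s<k∸hi))
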